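{- On $\textsf{Triangle}(6)$, every solution of the peg solitaire problem with starting vacancy c5 and finishing location a1 consists of at least 9 moves.
   Context: The board $\textsf{Triangle}(n)$ has the holes $(r,k)$ with integers $1\le k\le r\le n$ (row $r$ from the top, position $k$ from the left in the row); hole $(r,k)$ is written as the $k$-th letter of the alphabet followed by $r$, so a1 is the top corner and c5 $=(5,3)$. The six directions are $d\in\{(0,\pm1),(\pm1,0),(1,1),(-1,-1)\}$. A jump: if $h,h+d,h+2d$ are on the board, $h$ and $h+d$ hold pegs and $h+2d$ is empty, the peg at $h$ moves to $h+2d$ and the peg at $h+d$ is removed. A peg solitaire problem with starting vacancy $s$ and finishing location $f$: starting with pegs in every hole except $s$, perform jumps until a single peg remains, at $f$. A move is a maximal block of consecutive jumps made by the same peg; the number of moves of a solution is the number of such blocks. -}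

module Defs where

open import Data.Nat using (ℕ; suc; _+_; _≤ᵇ_)
open import Data.Nat.Properties using (_≟_)
open import Data.Bool using (Bool; true; false; _∧_; if_then_else_; T)
open import Data.Product using (_×_; _,_; Σ)
open import Data.Product.Properties using (≡-dec)
open import Data.List using (List; []; _∷_)
open import Relation.Nullary.Decidable using (⌊_⌋; Dec)
open import Relation.Binary.PropositionalEquality using (_≡_)
open import Function.Bundles using (_⇔_)

-- A hole (r , k): row r from the top, position k in the row.
Hole : Set
Hole = ℕ × ℕ

_≟ₕ_ : (x y : Hole) → Dec (x ≡ y)
_≟ₕ_ = ≡-dec _≟_ _≟_

onBoardᵇ : ℕ → Hole → Bool
onBoardᵇ n (r , k) = (1 ≤ᵇ k) ∧ (k ≤ᵇ r) ∧ (r ≤ᵇ n)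

OnBoard : ℕ → Hole → Set
OnBoard n h = T (onBoardᵇ n h)

data Line : Hole → Hole → Hole → Set where
  d+0+1 : ∀ r k → Line (r , k) (r , k + 1) (r , k + 2)
  d+0-1 : ∀ r k → Line (r , k + 2) (r , k + 1) (r , k)
  d+1+0 : ∀ r k → Line (r , k) (r + 1 , k) (r + 2 , k)
  d-1+0 : ∀ r k → Line (r + 2 , k) (r + 1 , k) (r , k)
  d+1+1 : ∀ r k → Line (r , k) (r + 1 , k + 1) (r + 2 , k + 2)
  d-1-1 : ∀ r k → Line (r + 2 , k + 2) (r + 1 , k + 1) (r , k)

State : Set
State = Hole → Bool

-- A jump (h , m , t): peg at h jumps over m into t.
Jump : Set
Jump = Hole × Hole × Hole

LegalJump : ℕ → State → Jump → Set
LegalJump n s (h , m , t) =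
  Line h m t × OnBoard n h × OnBoard n m × OnBoard n t ×
  s h ≡ true × s m ≡ true × s t ≡ false

applyJump : State → Jump → State
applyJump s (h , m , t) x =
  if ⌊ x ≟ₕ h ⌋ then false else
  if ⌊ x ≟ₕ m ⌋ then false else
  if ⌊ x ≟ₕ t ⌋ then true else s x

data Plays (n : ℕ) : State → List Jump → State → Set where
  done : ∀ {s} → Plays n s [] s
  step : ∀ {s s' j js} → LegalJump n s j →
         Plays n (applyJump s j) js s' → Plays n s (j ∷ js) s'

startState : ℕ → Hole → State
startState n v x = onBoardᵇ n x ∧ (if ⌊ x ≟ₕ v ⌋ then false else true)

Solution : ℕ → Hole → Hole → List Jump → Set
Solution n v f js =
  Σ State (λ s' → Plays n (startState n v) js s' × (∀ x → (s' x ≡ true) ⇔ (x ≡ f)))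

private
  from to : Jump → Hole
  from (h , _ , _) = h
  to   (_ , _ , t) = t

  -- blocks after a given previous jump: a new move starts whenever the
  -- jumping peg is not the peg that made the previous jump.
  moreMoves : Jump → List Jump → ℕ
  moreMoves prev [] = 0
  moreMoves prev (j ∷ js) =
    (if ⌊ from j ≟ₕ to prev ⌋ then 0 else 1) + moreMoves j js

-- Number of moves = number of maximal blocks of consecutive jumps by the same peg.
moves : List Jump → ℕ
moves [] = 0
moves (j ∷ js) = suc (moreMoves j js)

-- Call a peg untouched while it has neither moved nor been jumped over, and a block
-- of holes intact while all its pegs are untouched. Cover the corners and edges of
-- Triangle(6) by nine disjoint blocks: the three corners and six pairs of adjacent
-- edge holes, none containing the vacancy c5. A hole of a block can only be jumped
-- over along the edge, by a jump starting or ending inside the same block; so an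
-- intact block can only be broken by a jump starting at one of its pegs, and such a
-- jump opens a new move unless that peg had just been moving (and then it was no
-- longer untouched). Hence each jump breaks at most as many blocks as moves it
-- opens. All nine blocks are intact at the start and none at the end, when the only
-- peg left is the one that moved last.
module Submission where

open import Defs
open import Algebra.Properties.CommutativeSemigroup as CommSemigroup using ()
open import Data.Bool using (Bool; true; false; T; if_then_else_)
open import Data.Bool.Properties using (T-≡)
open import Data.Empty using (⊥-elim)
open import Data.Fin using (Fin; toℕ; fromℕ<)
open import Data.Fin.Properties using (toℕ-fromℕ<) renaming (all? to allFin?)
open import Data.Bool.ListAction using (all)
open import Data.List using (List; []; _∷_)
open import Data.List.Membership.DecPropositional _≟ₕ_ using (_∈_; _∉_; _∈?_)
open import Data.List.Membership.Propositional as Membership using ()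
open import Data.List.Relation.Binary.Disjoint.DecPropositional _≟ₕ_ using (Disjoint; disjoint?)
open import Data.List.Relation.Unary.All as All using (All; []; _∷_; all?)
open import Data.List.Relation.Unary.All.Properties using (all⁺; all⁻)
open import Data.List.Relation.Unary.AllPairs using (AllPairs; []; _∷_; allPairs?)
open import Data.List.Relation.Unary.Any using (here; there)
open import Data.Nat using (ℕ; suc; _+_; _≤_; _<_; _≤ᵇ_; z≤n; s≤s)
open import Data.Nat.Properties
open import Data.Product using (_×_; _,_; proj₁; proj₂; ∃)
open import Data.Sum using (_⊎_; inj₁; inj₂; [_,_]′)
open import Function using (_∘_)
open import Function.Bundles using (Equivalence)
open import Relation.Nullary using (¬_; Dec; yes; no)
open import Relation.Nullary.Decidable using (⌊_⌋; T?; _→-dec_; _⊎-dec_; toWitness)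
open import Relation.Binary.PropositionalEquality

open CommSemigroup +-commutativeSemigroup using (x∙yz≈y∙xz)

indicator : Bool → ℕ
indicator true  = 1
indicator false = 0

indicator≤1 : ∀ b → indicator b ≤ 1
indicator≤1 true  = ≤-refl
indicator≤1 false = z≤n

indicator-mono : ∀ {a b} → (T a → T b) → indicator a ≤ indicator b
indicator-mono {false}         _   = z≤n
indicator-mono {true} {true}   _   = ≤-refl
indicator-mono {true} {false} a⇒b = ⊥-elim (a⇒b _)

_⊆ˢ_ : State → State → Set
U ⊆ˢ s = ∀ x → T (U x) → T (s x)

AtMostOnePeg : State → Set
AtMostOnePeg s = ∀ {x y} → T (s x) → T (s y) → x ≡ y

movesAfter : Hole → List Jump → ℕ
movesAfter p []                = 0
movesAfter p ((h , _ , t) ∷ js) = (if ⌊ h ≟ₕ p ⌋ then 0 else 1) + movesAfter t js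

moves-∷ : ∀ h m t js → moves ((h , m , t) ∷ js) ≡ suc (movesAfter t js)
moves-∷ h m t []                   = refl
moves-∷ h m t ((h′ , m′ , t′) ∷ js) =
  cong (λ n → suc ((if ⌊ h′ ≟ₕ t ⌋ then 0 else 1) + n)) (suc-injective (moves-∷ h′ m′ t′ js))

touch : State → Jump → State
touch U (h , m , _) x = if ⌊ x ≟ₕ h ⌋ then false else if ⌊ x ≟ₕ m ⌋ then false else U x

touch-other : ∀ U {h m t x} → x ≢ h → x ≢ m → touch U (h , m , t) x ≡ U x
touch-other U {h} {m} {x = x} x≢h x≢m with x ≟ₕ h | x ≟ₕ m
... | yes x≡h | _       = ⊥-elim (x≢h x≡h)
... | no _    | yes x≡m = ⊥-elim (x≢m x≡m)
... | no _    | no _    = refl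

touch-⊆-applyJump : ∀ {U s} j → U ⊆ˢ s → touch U j ⊆ˢ applyJump s j
touch-⊆-applyJump {U} {s} (h , m , t) U⊆s x with x ≟ₕ h | x ≟ₕ m | x ≟ₕ t
... | yes _ | _     | _     = λ ()
... | no _  | yes _ | _     = λ ()
... | no _  | no _  | yes _ = λ _ → _
... | no _  | no _  | no _  = U⊆s x

occupied≢vacant : ∀ {s : State} {x y} → s x ≡ true → s y ≡ false → x ≢ y
occupied≢vacant sx sy refl with trans (sym sx) sy
... | ()

target-vacated : ∀ {n s h m t} → LegalJump n s (h , m , t) → t ≢ h × t ≢ m
target-vacated (_ , _ , _ , _ , sh , sm , st) =
  (λ t≡h → occupied≢vacant sh st (sym t≡h)) , (λ t≡m → occupied≢vacant sm st (sym t≡m))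

applyJump-target : ∀ {n s h m t} → LegalJump n s (h , m , t) → T (applyJump s (h , m , t) t)
applyJump-target {h = h} {m} {t} legal with t ≟ₕ h | t ≟ₕ m | t ≟ₕ t
... | yes t≡h | _       | _     = ⊥-elim (proj₁ (target-vacated legal) t≡h)
... | no _    | yes t≡m | _     = ⊥-elim (proj₂ (target-vacated legal) t≡m)
... | no _    | no _    | yes _ = _
... | no _    | no _    | no t≢t = ⊥-elim (t≢t refl)

touch-target : ∀ {n s U h m t} → LegalJump n s (h , m , t) → U ⊆ˢ s → ¬ T (touch U (h , m , t) t)
touch-target {U = U} {t = t} legal@(_ , _ , _ , _ , _ , _ , st) U⊆s touched =
  let t≢h , t≢m = target-vacated legal
  in subst T st (U⊆s t (subst T (touch-other U {t = t} t≢h t≢m) touched))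

intactCount : State → List (List Hole) → ℕ
intactCount U []       = 0
intactCount U (I ∷ Is) = indicator (all U I) + intactCount U Is

Respects : Jump → List Hole → Set
Respects (h , m , t) I = m ∈ I → h ∈ I ⊎ t ∈ I

record IsBlocking (n : ℕ) (Is : List (List Hole)) : Set where
  field
    disjoint  : AllPairs Disjoint Is
    nonEmpty  : All (_≢ []) Is
    respected : ∀ {s j} → LegalJump n s j → All (Respects j) Is

intact-lookup : ∀ {U x I} → x ∈ I → T (all U I) → T (U x)
intact-lookup {U} {I = I} x∈I intact = All.lookup (all⁺ U I intact) x∈I

intact-touch : ∀ {U h m t I} → h ∉ I → Respects (h , m , t) I → ¬ T (U t) →
               T (all U I) → T (all (touch U (h , m , t)) I)
intact-touch {U} {h} {m} {t} {I} h∉I respects ¬Ut intact = all⁻ _ (All.tabulate untouched)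
  where
  m∉I : m ∉ I
  m∉I m∈I with respects m∈I
  ... | inj₁ h∈I = h∉I h∈I
  ... | inj₂ t∈I = ¬Ut (intact-lookup t∈I intact)

  untouched : ∀ {x} → x ∈ I → T (touch U (h , m , t) x)
  untouched x∈I = subst T (sym (touch-other U {t = t} (λ { refl → h∉I x∈I }) (λ { refl → m∉I x∈I })))
                          (intact-lookup x∈I intact)

intactCount-touch-apart : ∀ {U h m t Is} → All (h ∉_) Is → All (Respects (h , m , t)) Is → ¬ T (U t) →
                          intactCount U Is ≤ intactCount (touch U (h , m , t)) Is
intactCount-touch-apart []             []                 ¬Ut = z≤n
intactCount-touch-apart (h∉I ∷ h∉Is) (respects ∷ resps) ¬Ut =
  +-mono-≤ (indicator-mono (intact-touch h∉I respects ¬Ut)) (intactCount-touch-apart h∉Is resps ¬Ut)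

-- Disjointness makes at most one block contain the jumping peg, and only that block can be broken.
intactCount-touch : ∀ {U h m t Is} → AllPairs Disjoint Is → All (Respects (h , m , t)) Is → ¬ T (U t) →
                    intactCount U Is ≤ indicator (U h) + intactCount (touch U (h , m , t)) Is
intactCount-touch []                  []                 ¬Ut = z≤n
intactCount-touch {U} {h} {m} {t} {I ∷ Is} (I#Is ∷ disjoint) (respects ∷ resps) ¬Ut with h ∈? I
... | yes h∈I = begin
  indicator (all U I) + intactCount U Is
    ≤⟨ +-mono-≤ (indicator-mono (intact-lookup h∈I)) (intactCount-touch-apart h∉Is resps ¬Ut) ⟩
  indicator (U h) + intactCount U′ Is
    ≤⟨ +-monoʳ-≤ (indicator (U h)) (m≤n+m _ _) ⟩
  indicator (U h) + (indicator (all U′ I) + intactCount U′ Is) ∎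
  where
  open ≤-Reasoning
  U′ : State
  U′ = touch U (h , m , t)
  h∉Is : All (h ∉_) Is
  h∉Is = All.map (λ I#J h∈J → I#J (h∈I , h∈J)) I#Is
... | no h∉I = begin
  indicator (all U I) + intactCount U Is
    ≤⟨ +-mono-≤ (indicator-mono (intact-touch h∉I respects ¬Ut)) (intactCount-touch disjoint resps ¬Ut) ⟩
  indicator (all U′ I) + (indicator (U h) + intactCount U′ Is)
    ≡⟨ x∙yz≈y∙xz (indicator (all U′ I)) (indicator (U h)) (intactCount U′ Is) ⟩
  indicator (U h) + (indicator (all U′ I) + intactCount U′ Is) ∎
  where
  open ≤-Reasoning
  U′ : State
  U′ = touch U (h , m , t)

intactCount-none : ∀ {U Is} → (∀ {x} → ¬ T (U x)) → All (_≢ []) Is → intactCount U Is ≡ 0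
intactCount-none ¬U []                    = refl
intactCount-none {Is = [] ∷ _} ¬U (I≢[] ∷ _) = ⊥-elim (I≢[] refl)
intactCount-none {U} {(x ∷ _) ∷ _} ¬U (_ ∷ nonEmpty) with U x in Ux
... | true  = ⊥-elim (¬U (subst T (sym Ux) _))
... | false = intactCount-none ¬U nonEmpty

intactCount-jump : ∀ {n Is s U h m t} → IsBlocking n Is → LegalJump n s (h , m , t) → U ⊆ˢ s →
                   intactCount U Is ≤ indicator (U h) + intactCount (touch U (h , m , t)) Is
intactCount-jump blocking legal@(_ , _ , _ , _ , _ , _ , st) U⊆s =
  intactCount-touch (disjoint blocking) (respected blocking legal) (λ Ut → subst T st (U⊆s _ Ut))
  where open IsBlocking

mutual
  -- p is where the previous jump landed: a jump from there continues the current move.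
  intactCount-≤-movesAfter : ∀ {n Is s js s′ U p} → IsBlocking n Is → Plays n s js s′ → U ⊆ˢ s →
                             ¬ T (U p) → T (s p) → AtMostOnePeg s′ → intactCount U Is ≤ movesAfter p js
  intactCount-≤-movesAfter {U = U} blocking done U⊆s ¬Up sp onePeg =
    ≤-reflexive (intactCount-none (λ Ux → ¬Up (subst (T ∘ U) (onePeg (U⊆s _ Ux) sp) Ux)) (IsBlocking.nonEmpty blocking))
  intactCount-≤-movesAfter {U = U} {p} blocking plays@(step {j = h , m , t} _ _) U⊆s ¬Up sp onePeg =
    ≤-trans (intactCount-≤-jump+movesAfter blocking plays U⊆s onePeg) (+-monoˡ-≤ _ (cost h))
    where
    cost : ∀ h → indicator (U h) ≤ (if ⌊ h ≟ₕ p ⌋ then 0 else 1)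
    cost h with h ≟ₕ p
    ... | yes refl = indicator-mono ¬Up
    ... | no _     = indicator≤1 (U h)

  intactCount-≤-jump+movesAfter : ∀ {n Is s h m t js s′ U} → IsBlocking n Is → Plays n s ((h , m , t) ∷ js) s′ →
                                  U ⊆ˢ s → AtMostOnePeg s′ → intactCount U Is ≤ indicator (U h) + movesAfter t js
  intactCount-≤-jump+movesAfter {h = h} {U = U} blocking (step {j = j} legal rest) U⊆s onePeg =
    ≤-trans (intactCount-jump blocking legal U⊆s)
            (+-monoʳ-≤ (indicator (U h))
              (intactCount-≤-movesAfter blocking rest (touch-⊆-applyJump j U⊆s) (touch-target legal U⊆s)
                (applyJump-target legal) onePeg))

intactCount-≤-moves : ∀ {n Is s h m t js s′ U} → IsBlocking n Is → Plays n s ((h , m , t) ∷ js) s′ →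
                      U ⊆ˢ s → AtMostOnePeg s′ → intactCount U Is ≤ moves ((h , m , t) ∷ js)
intactCount-≤-moves {Is = Is} {h = h} {m} {t} {js} {U = U} blocking plays U⊆s onePeg =
  subst (intactCount U Is ≤_) (sym (moves-∷ h m t js))
    (≤-trans (intactCount-≤-jump+movesAfter blocking plays U⊆s onePeg) (+-monoˡ-≤ _ (indicator≤1 (U h))))

RespectedOnBoard : ℕ → List (List Hole) → Jump → Set
RespectedOnBoard n Is (h , m , t) = OnBoard n h → OnBoard n m → OnBoard n t → All (Respects (h , m , t)) Is

respectedOnBoard? : ∀ n Is j → Dec (RespectedOnBoard n Is j)
respectedOnBoard? n Is (h , m , t) =
  T? (onBoardᵇ n h) →-dec (T? (onBoardᵇ n m) →-dec (T? (onBoardᵇ n t) →-dec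
    all? (λ I → (m ∈? I) →-dec ((h ∈? I) ⊎-dec (t ∈? I))) Is))

linesFrom : Hole → List Jump
linesFrom (r , k) =
  ((r , k) , (r , k + 1) , (r , k + 2)) ∷ ((r , k + 2) , (r , k + 1) , (r , k)) ∷
  ((r , k) , (r + 1 , k) , (r + 2 , k)) ∷ ((r + 2 , k) , (r + 1 , k) , (r , k)) ∷
  ((r , k) , (r + 1 , k + 1) , (r + 2 , k + 2)) ∷ ((r + 2 , k + 2) , (r + 1 , k + 1) , (r , k)) ∷ []

line-∈-linesFrom : ∀ {h m t} → Line h m t → ∃ λ e → (e ≡ h ⊎ e ≡ t) × (h , m , t) Membership.∈ linesFrom e
line-∈-linesFrom (d+0+1 r k) = (r , k) , inj₁ refl , here refl
line-∈-linesFrom (d+0-1 r k) = (r , k) , inj₂ refl , there (here refl)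
line-∈-linesFrom (d+1+0 r k) = (r , k) , inj₁ refl , there (there (here refl))
line-∈-linesFrom (d-1+0 r k) = (r , k) , inj₂ refl , there (there (there (here refl)))
line-∈-linesFrom (d+1+1 r k) = (r , k) , inj₁ refl , there (there (there (there (here refl))))
line-∈-linesFrom (d-1-1 r k) = (r , k) , inj₂ refl , there (there (there (there (there (here refl)))))

onBoard-bounded : ∀ {n r k} → OnBoard n (r , k) → r < suc n × k < suc n
onBoard-bounded {n} {r} {k} onBoard with 1 ≤ᵇ k | k ≤ᵇ r in k≤ᵇr | r ≤ᵇ n in r≤ᵇn
... | true | true | true = s≤s r≤n , s≤s (≤-trans k≤r r≤n)
  where
  r≤n : r ≤ n
  r≤n = ≤ᵇ⇒≤ r n (subst T (sym r≤ᵇn) _)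
  k≤r : k ≤ r
  k≤r = ≤ᵇ⇒≤ k r (subst T (sym k≤ᵇr) _)

onBoard-grid : ∀ {n} (P : Hole → Set) → ((i j : Fin (suc n)) → P (toℕ i , toℕ j)) → ∀ {e} → OnBoard n e → P e
onBoard-grid P grid {r , k} onBoard =
  let r< , k< = onBoard-bounded onBoard
  in subst₂ (λ r k → P (r , k)) (toℕ-fromℕ< r<) (toℕ-fromℕ< k<) (grid (fromℕ< r<) (fromℕ< k<))

respected-from-grid : ∀ {n Is} → ((i j : Fin (suc n)) → All (RespectedOnBoard n Is) (linesFrom (toℕ i , toℕ j))) →
                      ∀ {s j} → LegalJump n s j → All (Respects j) Is
respected-from-grid {n} {Is} grid (line , onH , onM , onT , _) =
  let e , endpoint , j∈ = line-∈-linesFrom line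
      onE = [ (λ e≡h → subst (OnBoard n) (sym e≡h) onH) , (λ e≡t → subst (OnBoard n) (sym e≡t) onT) ]′ endpoint
  in All.lookup (onBoard-grid (λ e → All (RespectedOnBoard n Is) (linesFrom e)) grid onE) j∈ onH onM onT

triangle6Blocks : List (List Hole)
triangle6Blocks =
  ((1 , 1) ∷ []) ∷ ((6 , 1) ∷ []) ∷ ((6 , 6) ∷ []) ∷
  ((2 , 1) ∷ (3 , 1) ∷ []) ∷ ((4 , 1) ∷ (5 , 1) ∷ []) ∷
  ((6 , 2) ∷ (6 , 3) ∷ []) ∷ ((6 , 4) ∷ (6 , 5) ∷ []) ∷
  ((2 , 2) ∷ (3 , 3) ∷ []) ∷ ((4 , 4) ∷ (5 , 5) ∷ []) ∷ []

triangle6Blocks-isBlocking : IsBlocking 6 triangle6Blocks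
triangle6Blocks-isBlocking = record
  { disjoint  = toWitness {a? = allPairs? disjoint? triangle6Blocks} _
  ; nonEmpty  = (λ ()) ∷ (λ ()) ∷ (λ ()) ∷ (λ ()) ∷ (λ ()) ∷ (λ ()) ∷ (λ ()) ∷ (λ ()) ∷ (λ ()) ∷ []
  ; respected = λ {s} {j} → respected-from-grid linesChecked {s} {j}
  }
  where
  linesChecked : (i j : Fin 7) → All (RespectedOnBoard 6 triangle6Blocks) (linesFrom (toℕ i , toℕ j))
  linesChecked = toWitness {a? = allFin? λ i → allFin? λ j →
                                   all? (respectedOnBoard? 6 triangle6Blocks) (linesFrom (toℕ i , toℕ j))} _

mainTheorem4 : (js : List Jump) → Solution 6 (5 , 3) (1 , 1) js → 9 ≤ moves js
mainTheorem4 [] (_ , done , onlyA1) with Equivalence.to (onlyA1 (2 , 1)) refl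
... | ()
mainTheorem4 (_ ∷ _) (s′ , plays , onlyA1) =
  intactCount-≤-moves triangle6Blocks-isBlocking plays (λ _ occupied → occupied) atMostOnePeg
  where
  atA1 : ∀ {x} → T (s′ x) → x ≡ (1 , 1)
  atA1 {x} occupied = Equivalence.to (onlyA1 x) (Equivalence.to T-≡ occupied)

  atMostOnePeg : AtMostOnePeg s′
  atMostOnePeg occupiedˣ occupiedʸ = trans (atA1 occupiedˣ) (sym (atA1 occupiedʸ))
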